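{- Let $\alpha\in\{+,-\}$ and let $G$ be an almost strong $\alpha$-radial with root $r$. Then for each block $C$ of $G$ over $r$, $\delta_C(r)$ contains exactly one edge $e_C$ such that the sign of $r$ over $e_C$ is $-\alpha$. Furthermore, $C-r$ is a strong $\beta_C$-radial with root $x_C$, where $x_C$ is the end of $e_C$ other than $r$ and $\beta_C$ is the sign of $x_C$ over $e_C$.
   Context: A bidirected graph $G$ is a finite graph (loops and parallel edges allowed) with maps $\partial_+,\partial_-:E(G)\to 2^{V(G)}$ such that for each edge $e$ with (possibly identical) ends $u,v$: $\partial_\alpha(e)\subseteq\{u,v\}$, $\partial_+(e)\cup\partial_-(e)=\{u,v\}$, and $\partial_+(e)\cap\partial_-(e)=\emptyset$ if $e$ is not a loop. If $u\in\partial_\alpha(e)$, the sign of $u$ over $e$ is $\alpha$; $-\alpha$ denotes the opposite sign. $\delta_G(X)$ is the set of edges joining $X$ and $V(G)\setminus X$. For a connected graph $G$ and vertex $v$, the blocks of $G$ over $v$ are the induced subgraphs $G[V(C)\cup\{v\}]$ for the connected components $C$ of $G-v$. A walk is a sequence $W=(w_1,\dots,w_k)$, $k$ odd, with $w_i$ a vertex for odd $i$ and $w_i$ an edge joining $w_{i-1},w_{i+1}$ for even $i$; closed over $r$ if $w_1=w_k=r$; a trail has no repeated edge. $W$ is a diwalk if to each traversal of an edge $w_i$ one can assign signs to its end-occurrences equal to the signs of these vertices over $w_i$ (for a loop with one end $+$ and one end $-$, the two assigned signs are distinct), such that at every internal vertex term the signs assigned from the preceding and following edges are distinct. A ditrail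 is a diwalk that is a trail. For $k\ge3$ the sign of $w_1$ (resp. $w_k$) over $W$ is the sign assigned at $w_2$ (resp. $w_{k-1}$); $W$ is an $(\alpha,\beta)$-ditrail if these are $\alpha,\beta$; the trivial ditrail $(v)$ counts as both a $(+,-)$- and a $(-,+)$-ditrail. $G$ is an $\alpha$-radial with root $r$ if every $v$ has an $(\alpha,-\alpha)$-ditrail from $v$ to $r$; it is strong if every $v$ also has a $(-\alpha,-\alpha)$-ditrail from $v$ to $r$; it is almost strong if every $v\in V(G)\setminus\{r\}$ has a $(-\alpha,-\alpha)$-ditrail from $v$ to $r$, but $G$ has no $(-\alpha,-\alpha)$-ditrail closed over $r$. -}

module Defs where

open import Data.Nat using (ℕ)
open import Data.Fin using (Fin)
open import Data.Bool using (Bool; true; false; if_then_else_)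
open import Data.List using (List; []; _∷_; [_]; map)
open import Data.List.Relation.Unary.Unique.Propositional using (Unique)
open import Data.Product using (Σ; _×_; _,_)
open import Data.Sum using (_⊎_)
open import Relation.Binary.PropositionalEquality using (_≡_; _≢_)
open import Relation.Nullary using (¬_)
open import Data.Unit using (⊤)

data Sign : Set where
  ⊕ ⊖ : Sign

neg : Sign → Sign
neg ⊕ = ⊖
neg ⊖ = ⊕

-- Each edge e has two end-occurrences (end₁ e, sgn₁ e) and (end₂ e, sgn₂ e);
-- the sign of a vertex u over e: u ∈ ∂_σ(e) iff some end-occurrence of e is (u , σ).
-- For a non-loop this is exactly the paper's ∂₊,∂₋ (disjoint, covering both ends);
-- for a loop at u, signs (⊕,⊖) give ∂₊=∂₋={u}, (⊕,⊕) give ∂₊={u},∂₋=∅, etc.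
record BiGraph : Set where
  field
    nV nE : ℕ
    end₁ end₂ : Fin nE → Fin nV
    sgn₁ sgn₂ : Fin nE → Sign

open BiGraph public

Vertex : BiGraph → Set
Vertex G = Fin (nV G)

Edge : BiGraph → Set
Edge G = Fin (nE G)

VSet : BiGraph → Set₁
VSet G = Vertex G → Set

-- A traversal of an edge: the edge, and whether it is traversed from end₂ to end₁.
record Step (G : BiGraph) : Set where
  constructor step
  field
    edge : Edge G
    flip : Bool

open Step public

tail : {G : BiGraph} → Step G → Vertex G
tail {G} (step e b) = if b then end₂ G e else end₁ G e

head : {G : BiGraph} → Step G → Vertex G
head {G} (step e b) = if b then end₁ G e else end₂ G e

tsign : {G : BiGraph} → Step G → Sign
tsign {G} (step e b) = if b then sgn₂ G e else sgn₁ G e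

hsign : {G : BiGraph} → Step G → Sign
hsign {G} (step e b) = if b then sgn₁ G e else sgn₂ G e

-- At each internal vertex the
-- assigned signs from the preceding and following edges are distinct.
data DiWalk (G : BiGraph) (S : VSet G) :
       Vertex G → Sign → List (Step G) → Vertex G → Sign → Set where
  single : (s : Step G) → S (tail s) → S (head s) →
           DiWalk G S (tail s) (tsign s) [ s ] (head s) (hsign s)
  cons   : (s : Step G) {ss : List (Step G)} {w : Vertex G} {β : Sign} →
           S (tail s) → S (head s) →
           DiWalk G S (head s) (neg (hsign s)) ss w β →
           DiWalk G S (tail s) (tsign s) (s ∷ ss) w β

-- (α,β)-ditrail from v to w in G[S]; the trivial ditrail (v) counts as an
-- (α, -α)-ditrail for both choices of α.
Ditrail : (G : BiGraph) → VSet G → Sign → Sign → Vertex G → Vertex G → Set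
Ditrail G S α β v w =
  (S v × v ≡ w × β ≡ neg α)
  ⊎ Σ (List (Step G)) (λ ss → DiWalk G S v α ss w β × Unique (map edge ss))

Radial : (G : BiGraph) → VSet G → Sign → Vertex G → Set
Radial G S α r = S r × (∀ v → S v → Ditrail G S α (neg α) v r)

StrongRadial : (G : BiGraph) → VSet G → Sign → Vertex G → Set
StrongRadial G S α r =
  Radial G S α r × (∀ v → S v → Ditrail G S (neg α) (neg α) v r)

AlmostStrongRadial : (G : BiGraph) → VSet G → Sign → Vertex G → Set
AlmostStrongRadial G S α r =
  Radial G S α r
  × (∀ v → S v → v ≢ r → Ditrail G S (neg α) (neg α) v r)
  × ¬ Ditrail G S (neg α) (neg α) r r

All : (G : BiGraph) → VSet G
All G _ = ⊤

data Conn (G : BiGraph) (S : VSet G) : Vertex G → Vertex G → Set where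
  here  : {u : Vertex G} → S u → Conn G S u u
  there : (s : Step G) {w : Vertex G} → S (tail s) → S (head s) →
          Conn G S (head s) w → Conn G S (tail s) w

CompOf : (G : BiGraph) → Vertex G → Vertex G → VSet G
CompOf G r c v = Conn G (λ u → u ≢ r) c v

Joins : (G : BiGraph) → Edge G → Vertex G → Sign → Vertex G → Sign → Set
Joins G e r σ x τ =
  (end₁ G e ≡ r × sgn₁ G e ≡ σ × end₂ G e ≡ x × sgn₂ G e ≡ τ)
  ⊎ (end₂ G e ≡ r × sgn₂ G e ≡ σ × end₁ G e ≡ x × sgn₁ G e ≡ τ)

module Submission where

-- As G has no
-- (-α,-α)-ditrail closed over r:
--   * first arrival: a ditrail from K to r arriving with -α first reaches r
--     through an edge at which r has sign -α, and stays in K before it;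
--   * crossing: two distinct such edges r x₁, r x₂ (signs β₁, β₂ at x₁, x₂)
--     cannot be linked by a ditrail avoiding r from x₁ with sign -β₁ to x₂
--     with sign -β₂, as the three would form a closed (-α,-α)-ditrail over r.
-- First arrival from c yields the edge e = r x, with sign β at x.  K is a
-- strong β-radial with root x by an ear decomposition: a routed set B ∋ x
-- (every vertex has ditrails in B to x with both leaving signs) grows along
-- the edges of K, each new vertex absorbed by an ear given by first arrival,
-- which by crossing must come back to B.  Uniqueness of e is then crossing
-- applied to the routes of K.

open import Defs
open import Data.Bool using (true; false; not)
open import Data.Empty using (⊥; ⊥-elim)
open import Data.Unit using (tt)
open import Data.Fin using (_≟_)
open import Data.List using (List; []; _∷_; _++_; [_])
open import Data.List.Relation.Unary.All using ([]; _∷_) renaming (All to Every)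
import Data.List.Relation.Unary.All as Every
open import Data.List.Relation.Unary.All.Properties using (++⁺; ++⁻ˡ; ++⁻ʳ; ¬Any⇒All¬)
open import Data.List.Relation.Unary.Any using (Any; here; there; any?)
open import Data.List.Relation.Unary.AllPairs using (AllPairs; []; _∷_)
import Data.List.Relation.Unary.AllPairs.Properties as AllPairs
open import Data.Product using (Σ; _×_; _,_; proj₁; proj₂)
open import Data.Sum using (_⊎_; inj₁; inj₂) renaming ([_,_]′ to either)
open import Relation.Binary.PropositionalEquality
  using (_≡_; _≢_; refl; sym; trans; cong; subst)
open import Relation.Nullary using (¬_; Dec; yes; no)
open import Relation.Nullary.Decidable using (_⊎-dec_)

neg-involutive : ∀ s → neg (neg s) ≡ s
neg-involutive ⊕ = refl
neg-involutive ⊖ = refl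

sign-dichotomy : ∀ s t → s ≡ t ⊎ s ≡ neg t
sign-dichotomy ⊕ ⊕ = inj₁ refl
sign-dichotomy ⊕ ⊖ = inj₂ refl
sign-dichotomy ⊖ ⊕ = inj₂ refl
sign-dichotomy ⊖ ⊖ = inj₁ refl

module Walks (G : BiGraph) where

  reverseStep : Step G → Step G
  reverseStep s = step (edge s) (not (flip s))

  reverseStep-tail : ∀ s → tail (reverseStep s) ≡ head s
  reverseStep-tail (step e true) = refl
  reverseStep-tail (step e false) = refl

  reverseStep-head : ∀ s → head (reverseStep s) ≡ tail s
  reverseStep-head (step e true) = refl
  reverseStep-head (step e false) = refl

  reverseStep-tsign : ∀ s → tsign (reverseStep s) ≡ hsign s
  reverseStep-tsign (step e true) = refl
  reverseStep-tsign (step e false) = refl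

  reverseStep-hsign : ∀ s → hsign (reverseStep s) ≡ tsign s
  reverseStep-hsign (step e true) = refl
  reverseStep-hsign (step e false) = refl

  stepEnd⇒edgeEnd : ∀ (s : Step G) {z} → z ≡ tail s ⊎ z ≡ head s →
                    z ≡ end₁ G (edge s) ⊎ z ≡ end₂ G (edge s)
  stepEnd⇒edgeEnd (step e true) (inj₁ q) = inj₂ q
  stepEnd⇒edgeEnd (step e true) (inj₂ q) = inj₁ q
  stepEnd⇒edgeEnd (step e false) (inj₁ q) = inj₁ q
  stepEnd⇒edgeEnd (step e false) (inj₂ q) = inj₂ q

  EdgeOf : VSet G → Edge G → Set
  EdgeOf S f = S (end₁ G f) × S (end₂ G f)

  stepEdgeOf : (S : VSet G) (s : Step G) → S (tail s) → S (head s) → EdgeOf S (edge s)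
  stepEdgeOf S (step e true) St Sh = Sh , St
  stepEdgeOf S (step e false) St Sh = St , Sh

  edgeOf-stepEnd : (S : VSet G) (s : Step G) {z : Vertex G} → z ≡ tail s ⊎ z ≡ head s →
                   EdgeOf S (edge s) → S z
  edgeOf-stepEnd S s p (q₁ , q₂) =
    either (λ z₁ → subst S (sym z₁) q₁) (λ z₂ → subst S (sym z₂) q₂) (stepEnd⇒edgeEnd s p)

  sameEdge-opposite : ∀ (s t : Step G) → edge s ≡ edge t → tail s ≢ tail t →
                      tail s ≡ head t × tsign s ≡ hsign t × head s ≡ tail t
  sameEdge-opposite (step e true) (step .e true) refl ne = ⊥-elim (ne refl)
  sameEdge-opposite (step e true) (step .e false) refl ne = refl , refl , refl
  sameEdge-opposite (step e false) (step .e true) refl ne = refl , refl , refl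
  sameEdge-opposite (step e false) (step .e false) refl ne = ⊥-elim (ne refl)

  -- Unlike DiWalk, the ends are fixed by equations, which makes
  -- concatenation and reversal structural.
  data Walk (S : VSet G) : Vertex G → Sign → List (Step G) → Vertex G → Sign → Set where
    stay : ∀ {v a w b} → v ≡ w → b ≡ neg a → S v → Walk S v a [] w b
    go   : ∀ {v a ss w b c} (s : Step G) → tail s ≡ v → tsign s ≡ a → S v →
           c ≡ neg (hsign s) → Walk S (head s) c ss w b → Walk S v a (s ∷ ss) w b

  castWalk : ∀ {S v a ss w b v′ a′ w′ b′} → v ≡ v′ → a ≡ a′ → w ≡ w′ → b ≡ b′ →
             Walk S v a ss w b → Walk S v′ a′ ss w′ b′
  castWalk refl refl refl refl W = W

  walkStart : ∀ {S v a ss w b} → Walk S v a ss w b → S v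
  walkStart (stay _ _ Sv) = Sv
  walkStart (go _ _ _ Sv _ _) = Sv

  oneStep : ∀ {S} (s : Step G) → S (tail s) → S (head s) →
            Walk S (tail s) (tsign s) [ s ] (head s) (hsign s)
  oneStep s a b = go s refl refl a refl (stay refl (sym (neg-involutive (hsign s))) b)

  append : ∀ {S v a xs w b w′ c ys u d} → Walk S v a xs w b → Walk S w′ c ys u d →
           w ≡ w′ → c ≡ neg b → Walk S v a (xs ++ ys) u d
  append (stay vw ba Sv) Y ww cb =
    castWalk (sym (trans vw ww)) (trans cb (trans (cong neg ba) (neg-involutive _))) refl refl Y
  append (go s t ts Sv ce R) Y ww cb = go s t ts Sv ce (append R Y ww cb)

  reverseSteps : List (Step G) → List (Step G)
  reverseSteps [] = []
  reverseSteps (s ∷ ss) = reverseSteps ss ++ [ reverseStep s ]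

  reverseWalk : ∀ {S v a xs w b} → Walk S v a xs w b → Walk S w b (reverseSteps xs) v a
  reverseWalk {S} (stay vw ba Sv) =
    stay (sym vw) (trans (sym (neg-involutive _)) (cong neg (sym ba))) (subst S vw Sv)
  reverseWalk {S} (go s refl refl Sv ce R) =
    append (reverseWalk R) back refl (trans (sym (neg-involutive _)) (cong neg (sym ce)))
    where
      back = castWalk (reverseStep-tail s) (reverseStep-tsign s) (reverseStep-head s)
                      (reverseStep-hsign s)
               (oneStep (reverseStep s) (subst S (sym (reverseStep-tail s)) (walkStart R))
                                        (subst S (sym (reverseStep-head s)) Sv))

  Visits : Vertex G → List (Step G) → VSet G
  Visits v ss z = z ≡ v ⊎ Any (λ s → z ≡ head s) ss

  visits? : ∀ v ss z → Dec (Visits v ss z)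
  visits? v ss z with z ≟ v | any? (λ s → z ≟ head s) ss
  ... | yes p | _ = yes (inj₁ p)
  ... | no _ | yes q = yes (inj₂ q)
  ... | no p | no q = no λ { (inj₁ x) → p x ; (inj₂ x) → q x }

  visits-first : ∀ {v s ss z} → Visits v (s ∷ ss) z → z ≡ v ⊎ Visits (head s) ss z
  visits-first (inj₁ p) = inj₁ p
  visits-first (inj₂ (here p)) = inj₂ (inj₁ p)
  visits-first (inj₂ (there p)) = inj₂ (inj₂ p)

  visits-rest : ∀ {v s ss z} → Visits (head s) ss z → Visits v (s ∷ ss) z
  visits-rest (inj₁ p) = inj₂ (here p)
  visits-rest (inj₂ p) = inj₂ (there p)

  visits-end : ∀ {S v a ss w b} → Walk S v a ss w b → Visits v ss w
  visits-end (stay vw _ _) = inj₁ (sym vw)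
  visits-end (go s t ts Sv ce R) = visits-rest (visits-end R)

  visits-inside : ∀ {S v a ss w b z} → Walk S v a ss w b → Visits v ss z → S z
  visits-inside (stay refl _ Sv) (inj₁ refl) = Sv
  visits-inside (go s t ts Sv ce R) p with visits-first p
  ... | inj₁ refl = Sv
  ... | inj₂ q = visits-inside R q

  restrictWalk : ∀ {S S′ v a ss w b} → Walk S v a ss w b → (∀ z → Visits v ss z → S′ z) →
                 Walk S′ v a ss w b
  restrictWalk (stay vw ba Sv) f = stay vw ba (f _ (inj₁ refl))
  restrictWalk (go s t ts Sv ce R) f =
    go s t ts (f _ (inj₁ refl)) ce (restrictWalk R (λ z p → f z (visits-rest p)))

  weakenWalk : ∀ {S S′ v a ss w b} → (∀ z → S z → S′ z) → Walk S v a ss w b → Walk S′ v a ss w b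
  weakenWalk f W = restrictWalk W (λ z p → f z (visits-inside W p))

  stepsWithin : ∀ {S v a ss w b} (R : VSet G) → Walk S v a ss w b → (∀ z → Visits v ss z → R z) →
                Every (λ s → R (tail s) × R (head s)) ss
  stepsWithin R (stay _ _ _) f = []
  stepsWithin R (go s refl ts Sv ce W) f =
    (f _ (inj₁ refl) , f _ (inj₂ (here refl))) ∷ stepsWithin R W (λ z p → f z (visits-rest p))

  walkEdgesOf : ∀ {S v a ss w b} → Walk S v a ss w b → Every (λ s → EdgeOf S (edge s)) ss
  walkEdgesOf {S} W =
    Every.map (λ { {s} (p , q) → stepEdgeOf S s p q }) (stepsWithin S W (λ z p → visits-inside W p))

  Distinct : List (Step G) → Set
  Distinct = AllPairs (λ s t → edge s ≢ edge t)

  Disjoint : List (Step G) → List (Step G) → Set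
  Disjoint xs ys = Every (λ s → Every (λ t → edge s ≢ edge t) ys) xs

  distinct-prefix : ∀ xs {ys} → Distinct (xs ++ ys) → Distinct xs
  distinct-prefix [] _ = []
  distinct-prefix (x ∷ xs) (a ∷ u) = ++⁻ˡ xs a ∷ distinct-prefix xs u

  distinct-before : ∀ xs {s ys} → Distinct (xs ++ s ∷ ys) → Every (λ t → edge t ≢ edge s) xs
  distinct-before [] u = []
  distinct-before (x ∷ xs) (a ∷ u) with ++⁻ʳ xs a
  ... | p ∷ _ = p ∷ distinct-before xs u

  every-reverse : ∀ {P : Edge G → Set} {xs} → Every (λ t → P (edge t)) xs →
                  Every (λ t → P (edge t)) (reverseSteps xs)
  every-reverse [] = []
  every-reverse (p ∷ ps) = ++⁺ (every-reverse ps) (p ∷ [])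

  distinct-reverse : ∀ {xs} → Distinct xs → Distinct (reverseSteps xs)
  distinct-reverse [] = []
  distinct-reverse {s ∷ ss} (a ∷ u) =
    AllPairs.++⁺ (distinct-reverse u) ([] ∷ [])
      (every-reverse {P = λ e → Every (λ t → e ≢ edge t) [ reverseStep s ]}
        (Every.map (λ ne → (λ q → ne (sym q)) ∷ []) a))

  disjoint-reverse : ∀ {xs ys} → Disjoint xs ys → Disjoint (reverseSteps xs) ys
  disjoint-reverse = every-reverse {P = λ e → Every (λ t → e ≢ edge t) _}

  disjoint-by : ∀ {P Q : Edge G → Set} {xs ys} → Every (λ t → P (edge t)) xs →
                Every (λ t → Q (edge t)) ys → (∀ e → P e → Q e → ⊥) → Disjoint xs ys
  disjoint-by [] q f = []
  disjoint-by (p ∷ ps) q f =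
    Every.map (λ {t} qt eq → f _ p (subst _ (sym eq) qt)) q ∷ disjoint-by ps q f

  disjoint-∷ : ∀ {xs s ys} → Every (λ t → edge t ≢ edge s) xs → Disjoint xs ys →
               Disjoint xs (s ∷ ys)
  disjoint-∷ [] [] = []
  disjoint-∷ (a ∷ as) (d ∷ ds) = (a ∷ d) ∷ disjoint-∷ as ds

  disjoint-[] : ∀ xs → Disjoint xs []
  disjoint-[] = Every.universal (λ _ → [])

  record Trail (S : VSet G) (v : Vertex G) (a : Sign) (w : Vertex G) (b : Sign) : Set where
    constructor trail
    field
      steps : List (Step G)
      walk : Walk S v a steps w b
      distinct : Distinct steps
  open Trail public

  castTrail : ∀ {S v a w b v′ a′ w′ b′} → v ≡ v′ → a ≡ a′ → w ≡ w′ → b ≡ b′ →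
              Trail S v a w b → Trail S v′ a′ w′ b′
  castTrail p q r s (trail ss W u) = trail ss (castWalk p q r s W) u

  weakenTrail : ∀ {S S′ v a w b} → (∀ z → S z → S′ z) → Trail S v a w b → Trail S′ v a w b
  weakenTrail f (trail ss W u) = trail ss (weakenWalk f W) u

  walk→diwalk : ∀ {S v a s ss w b} → Walk S v a (s ∷ ss) w b → DiWalk G S v a (s ∷ ss) w b
  walk→diwalk {S} (go s refl refl Sv refl (stay hw be Sh)) =
    subst (λ b → DiWalk G S (tail s) (tsign s) [ s ] _ b) (sym (trans be (neg-involutive _)))
      (subst (λ w → DiWalk G S (tail s) (tsign s) [ s ] w (hsign s)) hw (single s Sv Sh))
  walk→diwalk {S} (go s refl refl Sv refl R@(go _ _ _ Sh _ _)) = cons s Sv Sh (walk→diwalk R)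

  diwalk→walk : ∀ {S v a ss w b} → DiWalk G S v a ss w b → Walk S v a ss w b
  diwalk→walk (single s a b) = oneStep s a b
  diwalk→walk (cons s a b D) = go s refl refl a refl (diwalk→walk D)

  trail→ditrail : ∀ {S v a w b} → Trail S v a w b → Ditrail G S a b v w
  trail→ditrail (trail [] (stay vw ba Sv) u) = inj₁ (Sv , vw , ba)
  trail→ditrail (trail (s ∷ ss) W u) = inj₂ (s ∷ ss , walk→diwalk W , AllPairs.map⁺ u)

  ditrail→trail : ∀ {S v a w b} → Ditrail G S a b v w → Trail S v a w b
  ditrail→trail (inj₁ (Sv , vw , ba)) = trail [] (stay vw ba Sv) []
  ditrail→trail (inj₂ (ss , D , U)) = trail ss (diwalk→walk D) (AllPairs.map⁻ U)

  backThrough : ∀ {S p a c z₀ γ} (s : Step G) → tail s ≡ p → tsign s ≡ a → S p → S (head s) →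
                c ≡ neg (hsign s) → (Bk : Trail S p (neg a) z₀ γ) →
                Every (λ t → edge s ≢ edge t) (steps Bk) → Trail S (head s) (neg c) z₀ γ
  backThrough {S} s t ts Sp Sh ce Bk A =
    trail (reverseStep s ∷ steps Bk) (append back (walk Bk) refl refl) (A ∷ distinct Bk)
    where
      back = castWalk (reverseStep-tail s)
                      (trans (reverseStep-tsign s) (sym (trans (cong neg ce) (neg-involutive _))))
                      (trans (reverseStep-head s) t) (trans (reverseStep-hsign s) ts)
               (oneStep (reverseStep s) (subst S (sym (reverseStep-tail s)) Sh)
                                        (subst S (sym (trans (reverseStep-head s) t)) Sp))

  -- Ear lemma.  Then every vertex of X,
  -- with either leaving sign, is routed to z₀: forwards along X and then F,
  -- or backwards along X and then Bk.
  earRoutes : ∀ {S p a xs q b z₀ γ} → (X : Walk S p a xs q b) → Distinct xs →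
              (F : Trail S q (neg b) z₀ γ) → (Bk : Trail S p (neg a) z₀ γ) →
              Disjoint xs (steps F) → Disjoint xs (steps Bk) →
              ∀ z → Visits p xs z → ∀ s → Trail S z (neg s) z₀ γ
  earRoutes {a = a} (stay pq ba Sp) u F Bk dF dB z (inj₁ refl) s with sign-dichotomy s a
  ... | inj₁ refl = Bk
  ... | inj₂ refl = castTrail (sym pq) (cong neg ba) refl refl F
  earRoutes {a = a} X@(go st t ts Sp ce R) (uu ∷ us) F Bk dF dB z vp s with visits-first vp
  ... | inj₁ refl with sign-dichotomy s a
  ...   | inj₁ refl = Bk
  ...   | inj₂ refl =
    castTrail refl (sym (neg-involutive a)) refl refl
      (trail (st ∷ _ ++ steps F) (append X (walk F) refl refl)
             (AllPairs.++⁺ (uu ∷ us) (distinct F) dF))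
  earRoutes X@(go st t ts Sp ce R) (uu ∷ us) F Bk (_ ∷ dF) (d₀ ∷ dB) z vp s | inj₂ vq =
    earRoutes R us F (backThrough st t ts Sp (walkStart R) ce Bk d₀) dF
      (disjoint-∷ (Every.map (λ ne q → ne (sym q)) uu) dB) z vq s

  data FirstEntry (S P : VSet G) (v : Vertex G) (a : Sign) (xs : List (Step G)) : Set where
    enters : ∀ y t ys zs → xs ≡ ys ++ zs → Walk S v a ys y t → P y →
             Every (λ s → ¬ P (tail s)) ys → FirstEntry S P v a xs
    avoids : (∀ z → Visits v xs z → ¬ P z) → FirstEntry S P v a xs

  firstEntry : ∀ {S v a xs w b} (P : VSet G) → (∀ z → Dec (P z)) → Walk S v a xs w b →
               FirstEntry S P v a xs
  firstEntry {v = v} {a} P P? W with P? v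
  ... | yes pv = enters v (neg a) [] _ refl (stay refl refl (walkStart W)) pv []
  firstEntry P P? (stay vw ba Sv) | no npv = avoids (λ { z (inj₁ refl) → npv })
  firstEntry P P? (go s t ts Sv ce R) | no npv with firstEntry P P? R
  ... | enters y t′ ys zs eq W′ Py A =
    enters y t′ (s ∷ ys) zs (cong (s ∷_) eq) (go s t ts Sv ce W′) Py
           (subst (λ u → ¬ P u) (sym t) npv ∷ A)
  ... | avoids h = avoids (λ z p → either (λ q pz → npv (subst P q pz)) (h z) (visits-first p))

  splitAtEdge : ∀ {S v a xs w b g} → Walk S v a xs w b → Any (λ s → edge s ≡ g) xs →
    Σ (List (Step G)) λ ys₁ → Σ (Step G) λ sx → Σ (List (Step G)) λ ys₂ →
      xs ≡ ys₁ ++ sx ∷ ys₂ × edge sx ≡ g × Walk S v a ys₁ (tail sx) (neg (tsign sx))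
  splitAtEdge (go s t ts Sv ce R) (here eq) = [] , s , _ , refl , eq , stay (sym t) (cong neg ts) Sv
  splitAtEdge (go s t ts Sv ce R) (there p) with splitAtEdge R p
  ... | ys₁ , sx , ys₂ , eq , ge , W = s ∷ ys₁ , sx , ys₂ , cong (s ∷_) eq , ge , go s t ts Sv ce W

module Connectivity (G : BiGraph) (S : VSet G) where
  open Walks G using (reverseStep; reverseStep-tail; reverseStep-head)

  conn-end : ∀ {u v} → Conn G S u v → S v
  conn-end (here Sv) = Sv
  conn-end (there _ _ _ R) = conn-end R

  conn-snoc : ∀ {u v} → Conn G S u v → (s : Step G) → tail s ≡ v → S (head s) →
              Conn G S u (head s)
  conn-snoc (here Sv) s refl Sh = there s Sv Sh (here Sh)
  conn-snoc (there t St Sh R) s eq Sh′ = there t St Sh (conn-snoc R s eq Sh′)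

  conn-reverse : ∀ {u v} → Conn G S u v → Conn G S v u
  conn-reverse (here Sv) = here Sv
  conn-reverse (there s St Sh R) =
    subst (Conn G S _) (reverseStep-head s)
      (conn-snoc (conn-reverse R) (reverseStep s) (reverseStep-tail s)
                 (subst S (sym (reverseStep-head s)) St))

  conn-trans : ∀ {u v w} → Conn G S u v → Conn G S v w → Conn G S u w
  conn-trans (here _) Q = Q
  conn-trans (there s St Sh R) Q = there s St Sh (conn-trans R Q)

module EdgesAt (G : BiGraph) (r : Vertex G) where
  open Walks G using (EdgeOf)

  step→joins : ∀ (s : Step G) {x τ σ} → tail s ≡ x → tsign s ≡ τ → head s ≡ r → hsign s ≡ σ →
               Joins G (edge s) r σ x τ
  step→joins (step f false) t ts h hs = inj₂ (h , hs , t , ts)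
  step→joins (step f true) t ts h hs = inj₁ (h , hs , t , ts)

  leavingStep : ∀ {f σ x τ} → Joins G f r σ x τ →
    Σ (Step G) λ s → edge s ≡ f × tail s ≡ r × tsign s ≡ σ × head s ≡ x × hsign s ≡ τ
  leavingStep {f} (inj₁ (a , b , c , d)) = step f false , refl , a , b , c , d
  leavingStep {f} (inj₂ (a , b , c , d)) = step f true , refl , a , b , c , d

  enteringStep : ∀ {f σ x τ} → Joins G f r σ x τ →
    Σ (Step G) λ s → edge s ≡ f × tail s ≡ x × tsign s ≡ τ × head s ≡ r × hsign s ≡ σ
  enteringStep {f} (inj₁ (a , b , c , d)) = step f true , refl , c , d , a , b
  enteringStep {f} (inj₂ (a , b , c , d)) = step f false , refl , c , d , a , b

  joins-otherEnd : ∀ {f σ x τ x′ τ′} → Joins G f r σ x τ → Joins G f r σ x′ τ′ → x ≢ r →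
                   x ≡ x′ × τ ≡ τ′
  joins-otherEnd (inj₁ (_ , _ , c , d)) (inj₁ (_ , _ , c′ , d′)) ne =
    trans (sym c) c′ , trans (sym d) d′
  joins-otherEnd (inj₁ (_ , _ , c , _)) (inj₂ (a′ , _ , _ , _)) ne = ⊥-elim (ne (trans (sym c) a′))
  joins-otherEnd (inj₂ (_ , _ , c , _)) (inj₁ (a′ , _ , _ , _)) ne = ⊥-elim (ne (trans (sym c) a′))
  joins-otherEnd (inj₂ (_ , _ , c , d)) (inj₂ (_ , _ , c′ , d′)) ne =
    trans (sym c) c′ , trans (sym d) d′

  joins-notEdgeOf : ∀ {S : VSet G} {f σ x τ} → (∀ z → S z → z ≢ r) → Joins G f r σ x τ →
                    ¬ EdgeOf S f
  joins-notEdgeOf avoid (inj₁ (a , _)) (p , _) = avoid _ p a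
  joins-notEdgeOf avoid (inj₂ (a , _)) (_ , q) = avoid _ q a

module Blocks (G : BiGraph) (α : Sign) (r : Vertex G)
              (hyp : AlmostStrongRadial G (All G) α r) (c : Vertex G) (c≢r : c ≢ r) where
  open Walks G
  open Connectivity G (λ z → z ≢ r)
  open EdgesAt G r

  K : VSet G
  K = CompOf G r c

  K-avoids-r : ∀ z → K z → z ≢ r
  K-avoids-r _ = conn-end

  K-step : ∀ {u} → K u → (s : Step G) → tail s ≡ u → head s ≢ r → K (head s)
  K-step = conn-snoc

  toRoot : ∀ v → v ≢ r → ∀ σ → Trail (All G) v σ r (neg α)
  toRoot v v≢r σ with sign-dichotomy σ α
  ... | inj₁ refl = ditrail→trail (proj₂ (proj₁ hyp) v tt)
  ... | inj₂ refl = ditrail→trail (proj₁ (proj₂ hyp) v tt v≢r)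

  noClosedTrail : ¬ Trail (All G) r (neg α) r (neg α)
  noClosedTrail T = proj₂ (proj₂ hyp) (trail→ditrail T)

  -- Crossing: distinct edges f₁, f₂ at which r has sign -α cannot be linked
  -- by a trail avoiding r that leaves x₁ and enters x₂ with the signs opposite
  -- to theirs, for f₁, that trail and f₂ form a closed (-α,-α)-trail over r.
  crossing : ∀ {S f₁ f₂ x₁ x₂ β₁ β₂} → f₁ ≢ f₂ →
             Joins G f₁ r (neg α) x₁ β₁ → Joins G f₂ r (neg α) x₂ β₂ →
             (∀ z → S z → z ≢ r) → ¬ Trail S x₁ (neg β₁) x₂ (neg β₂)
  crossing {S} {β₂ = β₂} f₁≢f₂ J₁ J₂ avoid (trail ps P uP) with leavingStep J₁ | enteringStep J₂
  ... | s₁ , e₁ , t₁ , ts₁ , h₁ , hs₁ | s₂ , e₂ , t₂ , ts₂ , h₂ , hs₂ =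
    noClosedTrail (trail (s₁ ∷ ps ++ [ s₂ ]) closed (s₁-fresh ∷ rest-distinct))
    where
      closed : Walk (All G) r (neg α) (s₁ ∷ ps ++ [ s₂ ]) r (neg α)
      closed = go s₁ t₁ ts₁ tt (cong neg (sym hs₁))
                 (append (castWalk (sym h₁) refl refl refl (weakenWalk (λ _ _ → tt) P))
                         (castWalk t₂ ts₂ h₂ hs₂ (oneStep s₂ tt tt)) refl (sym (neg-involutive β₂)))
      s₁∉ps : Every (λ t → edge s₁ ≢ edge t) ps
      s₁∉ps = Every.map (λ et q → joins-notEdgeOf avoid J₁
                                    (subst (EdgeOf S) (sym (trans (sym e₁) q)) et))
                        (walkEdgesOf P)
      s₂∉ps : Every (λ t → edge t ≢ edge s₂) ps
      s₂∉ps = Every.map (λ et q → joins-notEdgeOf avoid J₂ (subst (EdgeOf S) (trans q e₂) et))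
                        (walkEdgesOf P)
      s₁-fresh : Every (λ t → edge s₁ ≢ edge t) (ps ++ [ s₂ ])
      s₁-fresh = ++⁺ s₁∉ps ((λ q → f₁≢f₂ (trans (sym e₁) (trans q e₂))) ∷ [])
      rest-distinct : Distinct (ps ++ [ s₂ ])
      rest-distinct = AllPairs.++⁺ uP ([] ∷ []) (Every.map (λ n → n ∷ []) s₂∉ps)

  record FirstArrival (v : Vertex G) (σ : Sign) (xs : List (Step G)) : Set where
    constructor arrival
    field
      f : Edge G
      x′ : Vertex G
      β′ : Sign
      joins : Joins G f r (neg α) x′ β′
      x′∈K : K x′
      before : Trail K v σ x′ (neg β′)
      isPrefix : Σ (List (Step G)) λ rest → xs ≡ steps before ++ rest

  -- If the trail first reached r with sign α at r, its remainder would be a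
  -- closed (-α,-α)-trail over r.
  firstArrival : ∀ {v σ xs} → K v → Walk (All G) v σ xs r (neg α) → Distinct xs →
                 FirstArrival v σ xs
  firstArrival Kv (stay v≡r _ _) _ = ⊥-elim (K-avoids-r _ Kv v≡r)
  firstArrival {v} {σ} Kv (go {ss = ss} s t ts _ ce R) (u ∷ us) with head s ≟ r
  ... | yes h≡r = arrival (edge s) v σ (step→joins s t ts h≡r arrives-neg-α) Kv
                          (trail [] (stay refl refl Kv) []) (_ , refl)
    where
      arrives-neg-α : hsign s ≡ neg α
      arrives-neg-α with sign-dichotomy (hsign s) α
      ... | inj₂ p = p
      ... | inj₁ p =
        ⊥-elim (noClosedTrail (trail ss (castWalk h≡r (trans ce (cong neg p)) refl refl R) us))
  ... | no h≢r with firstArrival (K-step Kv s t h≢r) R us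
  ...   | arrival f x′ β′ J Kx′ (trail ps P dP) (rest , ss≡) =
    arrival f x′ β′ J Kx′
      (trail (s ∷ ps) (go s t ts Kv ce P) (++⁻ˡ ps (subst (Every _) ss≡ u) ∷ dP))
      (rest , cong (s ∷_) ss≡)

  module Routing (e : Edge G) (x : Vertex G) (β : Sign)
                 (Je : Joins G e r (neg α) x β) (x∈K : K x) where

    record Routed : Set₁ where
      field
        B : VSet G
        B? : ∀ z → Dec (B z)
        B⊆K : ∀ z → B z → K z
        x∈B : B x
        route : ∀ z → B z → ∀ s → Trail B z (neg s) x (neg β)
    open Routed

    -- A route from w = head s ∉ B: back over s to tail s ∈ B, then along B.
    stepBack : (bl : Routed) (s : Step G) → B bl (tail s) → ¬ B bl (head s) →
               (S : VSet G) → (∀ z → B bl z → S z) → S (head s) →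
               Trail S (head s) (hsign s) x (neg β)
    stepBack bl s Bu w∉B S B⊆S Sw =
      castTrail refl (neg-involutive _) refl refl
        (backThrough s refl refl (B⊆S _ Bu) Sw refl (weakenTrail B⊆S R) s∉R)
      where
        R : Trail (B bl) (tail s) (neg (tsign s)) x (neg β)
        R = route bl (tail s) Bu (tsign s)
        -- the edges of R lie in G[B], and s has its head outside B
        s∉R : Every (λ t → edge s ≢ edge t) (steps R)
        s∉R = Every.map (λ et q → w∉B (edgeOf-stepEnd (B bl) s (inj₂ refl)
                                                       (subst (EdgeOf (B bl)) (sym q) et)))
                        (walkEdgesOf (walk R))

    stepBack-touches : (bl : Routed) (s : Step G) (Bu : B bl (tail s)) (w∉B : ¬ B bl (head s))
                       (S : VSet G) (B⊆S : ∀ z → B bl z → S z) (Sw : S (head s)) →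
                       Every (λ t → B bl (end₁ G (edge t)) ⊎ B bl (end₂ G (edge t)))
                             (steps (stepBack bl s Bu w∉B S B⊆S Sw))
    stepBack-touches bl s Bu w∉B S B⊆S Sw =
      either (λ q → inj₁ (subst (B bl) q Bu)) (λ q → inj₂ (subst (B bl) q Bu))
             (stepEnd⇒edgeEnd s (inj₁ refl))
      ∷ Every.map firstEnd (walkEdgesOf (walk (route bl (tail s) Bu (tsign s))))
      where
        firstEnd : ∀ {f} → EdgeOf (B bl) f → B bl (end₁ G f) ⊎ B bl (end₂ G f)
        firstEnd (p , _) = inj₁ p

    outside⇒notEdgeOf : (bl : Routed) {ys : List (Step G)} → Every (λ t → ¬ B bl (tail t)) ys →
                        Every (λ t → ¬ EdgeOf (B bl) (edge t)) ys
    outside⇒notEdgeOf bl = Every.map (λ {t} out et → out (edgeOf-stepEnd (B bl) t (inj₁ refl) et))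

    grownBy : Routed → Vertex G → List (Step G) → VSet G
    grownBy bl p xs z = B bl z ⊎ Visits p xs z

    extendByEar : (bl : Routed) {p q : Vertex G} {a b : Sign} {xs : List (Step G)} →
                  Walk K p a xs q b → Distinct xs →
                  (F : Trail (grownBy bl p xs) q (neg b) x (neg β)) →
                  (Bk : Trail (grownBy bl p xs) p (neg a) x (neg β)) →
                  Disjoint xs (steps F) → Disjoint xs (steps Bk) → Routed
    extendByEar bl {p} {xs = xs} X dX F Bk dF dBk = record
      { B = grownBy bl p xs
      ; B? = λ z → B? bl z ⊎-dec visits? p xs z
      ; B⊆K = λ z → either (B⊆K bl z) (visits-inside X)
      ; x∈B = inj₁ (x∈B bl)
      ; route = λ z → either (λ Bz s → weakenTrail (λ _ → inj₁) (route bl z Bz s))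
                             (earRoutes (restrictWalk X (λ _ → inj₂)) dX F Bk dF dBk z)
      }

    -- The first routed set: the trail from x leaving with -β first reaches r
    -- through e itself (another edge would cross e), so the part before is a
    -- closed trail at x, which routes each of its vertices by the ear lemma.
    initial : Routed
    initial with toRoot x (K-avoids-r x x∈K) (neg β)
    ... | T with firstArrival x∈K (walk T) (distinct T)
    ... | arrival f x′ β′ J _ P _ with e ≟ f
    ...   | no e≢f = ⊥-elim (crossing e≢f Je J K-avoids-r P)
    ...   | yes refl with joins-otherEnd Je J (K-avoids-r x x∈K)
    ...     | refl , refl = record
      { B = Visits x (steps P)
      ; B? = visits? x (steps P)
      ; B⊆K = λ z → visits-inside (walk P)
      ; x∈B = inj₁ refl
      ; route = earRoutes (restrictWalk (walk P) (λ z p → p)) (distinct P) atX atX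
                          (disjoint-[] (steps P)) (disjoint-[] (steps P))
      }
      where
        atX : Trail (Visits x (steps P)) x (neg (neg β)) x (neg β)
        atX = trail [] (stay refl (sym (neg-involutive (neg β))) (inj₁ refl)) []

    -- An ear from w = head s ∉ B (s leaving B) that never enters B cannot
    -- reach r first through an edge f: reversed and followed by stepBack it
    -- links f with e, and f ≠ e as x ∈ B; this contradicts crossing.
    earEntersRouted : (bl : Routed) (s : Step G) (Bu : B bl (tail s)) (w∉B : ¬ B bl (head s))
                      {f : Edge G} {x′ : Vertex G} {β′ : Sign} → Joins G f r (neg α) x′ β′ →
                      (P : Trail K (head s) (neg (hsign s)) x′ (neg β′)) →
                      ¬ (∀ z → Visits (head s) (steps P) z → ¬ B bl z)
    earEntersRouted bl s Bu w∉B {f} {x′} {β′} J P avoidsB = crossing f≢e J Je K-avoids-r linked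
      where
        f≢e : f ≢ e
        f≢e refl = avoidsB x′ (visits-end (walk P))
                     (subst (B bl) (proj₁ (joins-otherEnd Je J (K-avoids-r x x∈K))) (x∈B bl))
        back : Trail K (head s) (hsign s) x (neg β)
        back = stepBack bl s Bu w∉B K (B⊆K bl) (walkStart (walk P))
        -- the edges of P have no end in B, those of back have one
        disjoint : Disjoint (reverseSteps (steps P)) (steps back)
        disjoint = disjoint-reverse
          (disjoint-by (walkEdgesOf (restrictWalk {S′ = λ z → ¬ B bl z} (walk P) avoidsB))
                       (stepBack-touches bl s Bu w∉B K (B⊆K bl) (walkStart (walk P)))
                       λ { _ (n₁ , _) (inj₁ b) → n₁ b ; _ (_ , n₂) (inj₂ b) → n₂ b })
        linked : Trail K x′ (neg β′) x (neg β)
        linked = trail (reverseSteps (steps P) ++ steps back)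
                       (append (reverseWalk (walk P)) (walk back) refl (sym (neg-involutive _)))
                       (AllPairs.++⁺ (distinct-reverse (distinct P)) (distinct back) disjoint)

    backInto : (bl : Routed) (s : Step G) → B bl (tail s) → ¬ B bl (head s) → (ys : List (Step G)) →
               Trail (grownBy bl (head s) ys) (head s) (neg (neg (hsign s))) x (neg β)
    backInto bl s Bu w∉B ys =
      castTrail refl (sym (neg-involutive _)) refl refl
        (stepBack bl s Bu w∉B _ (λ _ → inj₁) (inj₂ (inj₁ refl)))

    backInto-disjoint : (bl : Routed) (s : Step G) (Bu : B bl (tail s)) (w∉B : ¬ B bl (head s))
                        {ys : List (Step G)} → Every (λ u → edge u ≢ edge s) ys →
                        Every (λ u → ¬ B bl (tail u)) ys → Disjoint ys (steps (backInto bl s Bu w∉B ys))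
    backInto-disjoint bl s Bu w∉B s∉ys out =
      disjoint-∷ s∉ys (disjoint-by (outside⇒notEdgeOf bl out)
                                   (walkEdgesOf (walk (route bl (tail s) Bu (tsign s)))) (λ _ n p → n p))

    -- If Y avoids the edge of s, Y is routed at y by B
    -- and at w by stepBack.  Otherwise Y returns to w over that edge, and its
    -- part before is a closed ear at w, routed at both ends by stepBack.
    absorbEar : (bl : Routed) (s : Step G) → B bl (tail s) → ¬ B bl (head s) →
                ∀ {y t ys} → Walk K (head s) (neg (hsign s)) ys y t → Distinct ys → B bl y →
                Every (λ u → ¬ B bl (tail u)) ys → Σ Routed (λ bl′ → B bl′ (head s))
    absorbEar bl s Bu w∉B {y} {t} {ys} Y dY y∈B out with any? (λ u → edge u ≟ edge s) ys
    ... | no s∉Y =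
      extendByEar bl Y dY F (backInto bl s Bu w∉B ys) dF
        (backInto-disjoint bl s Bu w∉B (¬Any⇒All¬ ys s∉Y) out) , inj₂ (inj₁ refl)
      where
        F : Trail (grownBy bl (head s) ys) y (neg t) x (neg β)
        F = weakenTrail (λ _ → inj₁) (route bl y y∈B t)
        dF : Disjoint ys (steps F)
        dF = disjoint-by (outside⇒notEdgeOf bl out) (walkEdgesOf (walk (route bl y y∈B t)))
                         (λ _ n p → n p)
    ... | yes s∈Y with splitAtEdge Y s∈Y
    ...   | ys₁ , sx , ys₂ , ys≡ , sx~s , Y₁ =
      extendByEar bl loop (distinct-prefix ys₁ dY′) Bk Bk dBk dBk , inj₂ (inj₁ refl)
      where
        dY′ : Distinct (ys₁ ++ sx ∷ ys₂)
        dY′ = subst Distinct ys≡ dY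
        out′ : Every (λ u → ¬ B bl (tail u)) (ys₁ ++ sx ∷ ys₂)
        out′ = subst (Every _) ys≡ out
        Bk : Trail (grownBy bl (head s) ys₁) (head s) (neg (neg (hsign s))) x (neg β)
        Bk = backInto bl s Bu w∉B ys₁
        dBk : Disjoint ys₁ (steps Bk)
        dBk = backInto-disjoint bl s Bu w∉B
                (Every.map (λ n q → n (trans q (sym sx~s))) (distinct-before ys₁ dY′)) (++⁻ˡ ys₁ out′)
        -- sx starts outside B, so it traverses s backwards and ends at w
        sx∉B : ¬ B bl (tail sx)
        sx∉B with ++⁻ʳ ys₁ out′
        ... | p ∷ _ = p
        opposite : tail sx ≡ head s × tsign sx ≡ hsign s × head sx ≡ tail s
        opposite = sameEdge-opposite sx s sx~s (λ q → sx∉B (subst (B bl) (sym q) Bu))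
        loop : Walk K (head s) (neg (hsign s)) ys₁ (head s) (neg (hsign s))
        loop = castWalk refl refl (proj₁ opposite) (cong neg (proj₁ (proj₂ opposite))) Y₁

    -- Absorbing w = head s for a step s inside K leaving B: follow the trail
    -- from w (leaving with -hsign s) to r up to its first arrival, and cut it
    -- where it first enters B, which it must.
    grow : (bl : Routed) (s : Step G) → B bl (tail s) → K (head s) → Σ Routed (λ bl′ → B bl′ (head s))
    grow bl s Bu Kw with B? bl (head s)
    ... | yes w∈B = bl , w∈B
    ... | no w∉B with toRoot (head s) (K-avoids-r _ Kw) (neg (hsign s))
    ...   | T with firstArrival Kw (walk T) (distinct T)
    ...     | arrival f x′ β′ J _ P _ with firstEntry (B bl) (B? bl) (walk P)
    ...       | avoids avoidsB = ⊥-elim (earEntersRouted bl s Bu w∉B J P avoidsB)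
    ...       | enters y t ys zs steps≡ Y y∈B out =
      absorbEar bl s Bu w∉B Y (distinct-prefix ys (subst Distinct steps≡ (distinct P))) y∈B out

    absorbPath : (bl : Routed) → ∀ {u v} → Conn G (λ z → z ≢ r) u v → B bl u →
                 Σ Routed (λ bl′ → B bl′ v)
    absorbPath bl (here _) Bu = bl , Bu
    absorbPath bl (there s _ h≢r P) Bu with grow bl s Bu (K-step (B⊆K bl _ Bu) s refl h≢r)
    ... | bl′ , Bw = absorbPath bl′ P Bw

    routeInK : ∀ v → K v → ∀ s → Trail K v (neg s) x (neg β)
    routeInK v Kv s with absorbPath initial (conn-trans (conn-reverse x∈K) Kv) (x∈B initial)
    ... | bl , Bv = weakenTrail (B⊆K bl) (route bl v Bv s)

    strongRadial : StrongRadial G K β x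
    strongRadial =
      (x∈K , λ v Kv → trail→ditrail
                        (castTrail refl (neg-involutive β) refl refl (routeInK v Kv (neg β))))
      , λ v Kv → trail→ditrail (routeInK v Kv β)

    -- Any edge at which r has sign -α with other end x′ ∈ K is e: otherwise
    -- the route from x′ to x would cross it with e.
    uniqueEdge : ∀ e′ x′ γ → K x′ → Joins G e′ r (neg α) x′ γ → e′ ≡ e
    uniqueEdge e′ x′ γ Kx′ J′ with e′ ≟ e
    ... | yes e′≡e = e′≡e
    ... | no e′≢e = ⊥-elim (crossing e′≢e J′ Je K-avoids-r (routeInK x′ Kx′ γ))

lemma10p10 : (G : BiGraph) (α : Sign) (r : Vertex G) →
    AlmostStrongRadial G (All G) α r →
    (c : Vertex G) → c ≢ r →
    Σ (Edge G) λ e → Σ (Vertex G) λ x → Σ Sign λ β →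
    CompOf G r c x
    × Joins G e r (neg α) x β
    × (∀ e′ x′ γ → CompOf G r c x′ → Joins G e′ r (neg α) x′ γ → e′ ≡ e)
    × StrongRadial G (CompOf G r c) β x
lemma10p10 G α r hyp c c≢r = e , x , β , x∈K , Je , uniqueEdge , strongRadial
  where
    open Blocks G α r hyp c c≢r
    open Walks G using (Trail; walk; distinct)
    fromC : Trail (All G) c α r (neg α)
    fromC = toRoot c c≢r α
    open FirstArrival (firstArrival (here c≢r) (walk fromC) (distinct fromC))
      renaming (f to e; x′ to x; β′ to β; joins to Je; x′∈K to x∈K)
    open Routing e x β Je x∈K
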